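{- Let $k\ge1$ and $X,Y\in\mathrm{Mat}_k(\mathbb{Z}_{\ge1})$. Then $\mathrm{size}_2(X)+\mathrm{size}_2(Y)\le \mathrm{size}_2(X\otimes Y)+2k^2-1$.
   Context: $X\otimes Y$ is the max-times product: $(X\otimes Y)_{ij}=\max_{1\le l\le k}(x_{il}\cdot y_{lj})$. For a positive integer $a$, $\mathrm{size}_2(a)=\lfloor\log_2 a\rfloor+1$; for a $k\times k$ matrix $A=(a_{ij})$, $\mathrm{size}_2(A)=\sum_{i=1}^k\sum_{j=1}^k\mathrm{size}_2(a_{ij})+k^2-1$. -}

module Defs where

open import Data.Nat using (ℕ; zero; suc; _+_; _*_; _∸_; _⊔_)
open import Data.Nat.Logarithm using (⌊log₂_⌋)
open import Data.Fin using (Fin; zero; suc)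

Mat : ℕ → Set
Mat k = Fin k → Fin k → ℕ

-- maximum of f 0, …, f (n-1) (0 for n = 0; only used with n ≥ 1)
maxFin : (n : ℕ) → (Fin n → ℕ) → ℕ
maxFin zero    f = 0
maxFin (suc n) f = f zero ⊔ maxFin n (λ i → f (suc i))

sumFin : (n : ℕ) → (Fin n → ℕ) → ℕ
sumFin zero    f = 0
sumFin (suc n) f = f zero + sumFin n (λ i → f (suc i))

_⊗_ : {k : ℕ} → Mat k → Mat k → Mat k
_⊗_ {k} X Y i j = maxFin k (λ l → X i l * Y l j)

size₂ : ℕ → ℕ
size₂ a = ⌊log₂ a ⌋ + 1

size₂M : (k : ℕ) → Mat k → ℕ
size₂M k A = sumFin k (λ i → sumFin k (λ j → size₂ (A i j))) + k * k ∸ 1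

{-# OPTIONS --safe #-}

-- For a, b ≥ 1 we have size₂ a + size₂ b ≤ size₂ (a b) + 1, and x_il y_lj ≤ (X ⊗ Y)_ij
-- for every l. Choosing l = i + j mod k pairs the k² positions (i, j) with the entries
-- x_il and y_lj so that every entry of X and every entry of Y is used exactly once,
-- since i + j mod k is a bijection in j for fixed i and in i for fixed j. Summing gives
-- Σ size₂ x + Σ size₂ y ≤ Σ size₂ (X ⊗ Y) + k², and the claim follows by adding the
-- k² − 1 offsets.
module Submission where

open import Defs
open import Data.Nat using (ℕ; _+_; _*_; _∸_; _≤_)
open import Data.Fin using (Fin)

open import Data.Nat using (zero; suc; _^_; _%_; ⌊_/2⌋; ⌈_/2⌉; NonZero; >-nonZero; >-nonZero⁻¹)
open import Data.Nat.Properties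
open import Data.Nat.DivMod using (_mod_; %-distribˡ-+; m%n%n≡m%n; [m+n]%n≡m%n; m<n⇒m%n≡m)
open import Data.Nat.Logarithm using (⌊log₂_⌋; ⌊log₂⌋-mono-≤; ⌊log₂⌊n/2⌋⌋≡⌊log₂n⌋∸1; ⌊log₂[2^n]⌋≡n)
open import Data.Nat.Tactic.RingSolver using (solve-∀)
open import Data.Fin using (zero; suc; toℕ)
open import Data.Fin.Properties using (toℕ-injective; toℕ-fromℕ<; toℕ≤n; toℕ<n)
open import Data.Fin.Permutation using (Permutation; permutation)
open import Relation.Binary.PropositionalEquality
open import Algebra.Properties.CommutativeMonoid.Sum +-0-commutativeMonoid
  using (sum; sum-syntax; sum-cong-≗; ∑-distrib-+; ∑-comm; sum-permute)

2*⌊n/2⌋≤n : ∀ n → 2 * ⌊ n /2⌋ ≤ n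
2*⌊n/2⌋≤n n = begin
  2 * ⌊ n /2⌋        ≡⟨ cong (⌊ n /2⌋ +_) (+-identityʳ ⌊ n /2⌋) ⟩
  ⌊ n /2⌋ + ⌊ n /2⌋  ≤⟨ +-monoʳ-≤ ⌊ n /2⌋ (⌊n/2⌋≤⌈n/2⌉ n) ⟩
  ⌊ n /2⌋ + ⌈ n /2⌉  ≡⟨ ⌊n/2⌋+⌈n/2⌉≡n n ⟩
  n                  ∎
  where open ≤-Reasoning

2^⌊log₂n⌋≤n : ∀ n .{{_ : NonZero n}} → 2 ^ ⌊log₂ n ⌋ ≤ n
2^⌊log₂n⌋≤n n = bound ⌊log₂ n ⌋ n refl
  where
  open ≤-Reasoning
  -- induction on the value of the logarithm, as halving m is not structural
  bound : ∀ e m .{{_ : NonZero m}} → ⌊log₂ m ⌋ ≡ e → 2 ^ e ≤ m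
  bound zero    m _ = >-nonZero⁻¹ m
  bound (suc e) 1 ()
  bound (suc e) m@(suc (suc _)) log≡ = begin
    2 * 2 ^ e    ≤⟨ *-monoʳ-≤ 2 (bound e ⌊ m /2⌋ half-log≡) ⟩
    2 * ⌊ m /2⌋  ≤⟨ 2*⌊n/2⌋≤n m ⟩
    m            ∎
    where
    half-log≡ : ⌊log₂ ⌊ m /2⌋ ⌋ ≡ e
    half-log≡ = trans (⌊log₂⌊n/2⌋⌋≡⌊log₂n⌋∸1 m) (cong (_∸ 1) log≡)

⌊log₂m⌋+⌊log₂n⌋≤⌊log₂[m*n]⌋ : ∀ m n .{{_ : NonZero m}} .{{_ : NonZero n}} →
                               ⌊log₂ m ⌋ + ⌊log₂ n ⌋ ≤ ⌊log₂ (m * n) ⌋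
⌊log₂m⌋+⌊log₂n⌋≤⌊log₂[m*n]⌋ m n = begin
  ⌊log₂ m ⌋ + ⌊log₂ n ⌋                    ≡⟨ ⌊log₂[2^n]⌋≡n _ ⟨
  ⌊log₂ (2 ^ (⌊log₂ m ⌋ + ⌊log₂ n ⌋)) ⌋     ≡⟨ cong ⌊log₂_⌋ (^-distribˡ-+-* 2 ⌊log₂ m ⌋ ⌊log₂ n ⌋) ⟩
  ⌊log₂ (2 ^ ⌊log₂ m ⌋ * 2 ^ ⌊log₂ n ⌋) ⌋  ≤⟨ ⌊log₂⌋-mono-≤ (*-mono-≤ (2^⌊log₂n⌋≤n m) (2^⌊log₂n⌋≤n n)) ⟩
  ⌊log₂ (m * n) ⌋                          ∎
  where open ≤-Reasoning

size₂-mono-≤ : ∀ {m n} → m ≤ n → size₂ m ≤ size₂ n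
size₂-mono-≤ m≤n = +-monoˡ-≤ 1 (⌊log₂⌋-mono-≤ m≤n)

size₂[m]+size₂[n]≤size₂[m*n]+1 : ∀ m n .{{_ : NonZero m}} .{{_ : NonZero n}} →
                                 size₂ m + size₂ n ≤ size₂ (m * n) + 1
size₂[m]+size₂[n]≤size₂[m*n]+1 m n = begin
  (⌊log₂ m ⌋ + 1) + (⌊log₂ n ⌋ + 1)  ≡⟨ regroup ⌊log₂ m ⌋ ⌊log₂ n ⌋ ⟩
  (⌊log₂ m ⌋ + ⌊log₂ n ⌋ + 1) + 1    ≤⟨ +-monoˡ-≤ 1 (+-monoˡ-≤ 1 (⌊log₂m⌋+⌊log₂n⌋≤⌊log₂[m*n]⌋ m n)) ⟩
  (⌊log₂ (m * n) ⌋ + 1) + 1          ∎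
  where
  open ≤-Reasoning
  regroup : ∀ a b → (a + 1) + (b + 1) ≡ (a + b + 1) + 1
  regroup = solve-∀

f[i]≤maxFin : ∀ n (f : Fin n → ℕ) i → f i ≤ maxFin n f
f[i]≤maxFin (suc n) f zero    = m≤m⊔n _ _
f[i]≤maxFin (suc n) f (suc i) = ≤-trans (f[i]≤maxFin n (λ i → f (suc i)) i) (m≤n⊔m _ _)

sumFin≡sum : ∀ n (f : Fin n → ℕ) → sumFin n f ≡ sum f
sumFin≡sum zero    f = refl
sumFin≡sum (suc n) f = cong (f zero +_) (sumFin≡sum n (λ i → f (suc i)))

sum-mono-≤ : ∀ {n} {f g : Fin n → ℕ} → (∀ i → f i ≤ g i) → sum f ≤ sum g
sum-mono-≤ {zero}  f≤g = ≤-refl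
sum-mono-≤ {suc n} f≤g = +-mono-≤ (f≤g zero) (sum-mono-≤ (λ i → f≤g (suc i)))

sum-const : ∀ n c → ∑[ i < n ] c ≡ n * c
sum-const zero    c = refl
sum-const (suc n) c = cong (c +_) (sum-const n c)

[m+n%d]%d≡[m+n]%d : ∀ m n d .{{_ : NonZero d}} → (m + n % d) % d ≡ (m + n) % d
[m+n%d]%d≡[m+n]%d m n d = begin
  (m + n % d) % d            ≡⟨ %-distribˡ-+ m (n % d) d ⟩
  (m % d + n % d % d) % d    ≡⟨ cong (λ r → (m % d + r) % d) (m%n%n≡m%n n d) ⟩
  (m % d + n % d) % d        ≡⟨ %-distribˡ-+ m n d ⟨
  (m + n) % d                ∎
  where open ≡-Reasoning

module CyclicShift (n : ℕ) .{{_ : NonZero n}} where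

  shiftBy : ℕ → Fin n → Fin n
  shiftBy a j = (a + toℕ j) mod n

  shiftBy-inverse : ∀ {a b} → a + b ≡ n → ∀ j → shiftBy a (shiftBy b j) ≡ j
  shiftBy-inverse {a} {b} a+b≡n j = toℕ-injective (begin
    toℕ (shiftBy a (shiftBy b j))   ≡⟨ toℕ-fromℕ< _ ⟩
    (a + toℕ (shiftBy b j)) % n     ≡⟨ cong (λ r → (a + r) % n) (toℕ-fromℕ< _) ⟩
    (a + (b + toℕ j) % n) % n       ≡⟨ [m+n%d]%d≡[m+n]%d a (b + toℕ j) n ⟩
    (a + (b + toℕ j)) % n           ≡⟨ cong (_% n) (+-assoc a b (toℕ j)) ⟨
    (a + b + toℕ j) % n             ≡⟨ cong (λ r → (r + toℕ j) % n) a+b≡n ⟩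
    (n + toℕ j) % n                 ≡⟨ cong (_% n) (+-comm n (toℕ j)) ⟩
    (toℕ j + n) % n                 ≡⟨ [m+n]%n≡m%n (toℕ j) n ⟩
    toℕ j % n                       ≡⟨ m<n⇒m%n≡m (toℕ<n j) ⟩
    toℕ j                           ∎)
    where open ≡-Reasoning

  shift : Fin n → Permutation n n
  shift i = permutation (shiftBy (toℕ i)) (shiftBy (n ∸ toℕ i))
    (shiftBy-inverse (m+[n∸m]≡n (toℕ≤n i)))
    (shiftBy-inverse (m∸n+n≡m (toℕ≤n i)))

  _⊕_ : Fin n → Fin n → Fin n
  i ⊕ j = shiftBy (toℕ i) j

  ⊕-comm : ∀ i j → i ⊕ j ≡ j ⊕ i
  ⊕-comm i j = cong (_mod n) (+-comm (toℕ i) (toℕ j))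

  sum-⊕ʳ : ∀ (f : Fin n → ℕ) i → sum f ≡ ∑[ j < n ] f (i ⊕ j)
  sum-⊕ʳ f i = sum-permute f (shift i)

  sum-⊕ˡ : ∀ (f : Fin n → ℕ) j → sum f ≡ ∑[ i < n ] f (i ⊕ j)
  sum-⊕ˡ f j = trans (sum-⊕ʳ f j) (sum-cong-≗ (λ i → cong f (⊕-comm j i)))

  ∑∑-latin-pairing : ∀ (a b c : Fin n → Fin n → ℕ) →
                     (∀ i j → a i (i ⊕ j) + b (i ⊕ j) j ≤ c i j) →
                     ∑[ i < n ] ∑[ j < n ] a i j + ∑[ i < n ] ∑[ j < n ] b i j ≤ ∑[ i < n ] ∑[ j < n ] c i j
  ∑∑-latin-pairing a b c a+b≤c = begin
    ∑[ i < n ] ∑[ j < n ] a i j + ∑[ i < n ] ∑[ j < n ] b i j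
      ≡⟨ cong₂ _+_ rows columns ⟩
    ∑[ i < n ] ∑[ j < n ] a i (i ⊕ j) + ∑[ i < n ] ∑[ j < n ] b (i ⊕ j) j
      ≡⟨ ∑-distrib-+ (λ i → ∑[ j < n ] a i (i ⊕ j)) (λ i → ∑[ j < n ] b (i ⊕ j) j) ⟨
    ∑[ i < n ] (∑[ j < n ] a i (i ⊕ j) + ∑[ j < n ] b (i ⊕ j) j)
      ≡⟨ sum-cong-≗ (λ i → ∑-distrib-+ (λ j → a i (i ⊕ j)) (λ j → b (i ⊕ j) j)) ⟨
    ∑[ i < n ] ∑[ j < n ] (a i (i ⊕ j) + b (i ⊕ j) j)
      ≤⟨ sum-mono-≤ (λ i → sum-mono-≤ (a+b≤c i)) ⟩
    ∑[ i < n ] ∑[ j < n ] c i j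
      ∎
    where
    open ≤-Reasoning
    rows : ∑[ i < n ] ∑[ j < n ] a i j ≡ ∑[ i < n ] ∑[ j < n ] a i (i ⊕ j)
    rows = sum-cong-≗ (λ i → sum-⊕ʳ (a i) i)
    columns : ∑[ i < n ] ∑[ j < n ] b i j ≡ ∑[ i < n ] ∑[ j < n ] b (i ⊕ j) j
    columns = begin-equality
      ∑[ i < n ] ∑[ j < n ] b i j          ≡⟨ ∑-comm b ⟩
      ∑[ j < n ] ∑[ i < n ] b i j          ≡⟨ sum-cong-≗ (λ j → sum-⊕ˡ (λ l → b l j) j) ⟩
      ∑[ j < n ] ∑[ i < n ] b (i ⊕ j) j    ≡⟨ ∑-comm (λ i j → b (i ⊕ j) j) ⟨
      ∑[ i < n ] ∑[ j < n ] b (i ⊕ j) j    ∎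

∑size₂ : (k : ℕ) → Mat k → ℕ
∑size₂ k A = sumFin k (λ i → sumFin k (λ j → size₂ (A i j)))

∑size₂≡∑∑ : ∀ k (A : Mat k) → ∑size₂ k A ≡ ∑[ i < k ] ∑[ j < k ] size₂ (A i j)
∑size₂≡∑∑ k A = trans (sumFin≡sum k _) (sum-cong-≗ (λ i → sumFin≡sum k (λ j → size₂ (A i j))))

size₂-⊗-entry : ∀ {k} (X Y : Mat k) i l j → 1 ≤ X i l → 1 ≤ Y l j →
                size₂ (X i l) + size₂ (Y l j) ≤ size₂ ((X ⊗ Y) i j) + 1
size₂-⊗-entry {k} X Y i l j 1≤x 1≤y = begin
  size₂ (X i l) + size₂ (Y l j)  ≤⟨ size₂[m]+size₂[n]≤size₂[m*n]+1 _ _ {{>-nonZero 1≤x}} {{>-nonZero 1≤y}} ⟩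
  size₂ (X i l * Y l j) + 1      ≤⟨ +-monoˡ-≤ 1 (size₂-mono-≤ (f[i]≤maxFin k (λ l → X i l * Y l j) l)) ⟩
  size₂ ((X ⊗ Y) i j) + 1        ∎
  where open ≤-Reasoning

∑size₂-⊗ : ∀ k .{{_ : NonZero k}} (X Y : Mat k) → (∀ i j → 1 ≤ X i j) → (∀ i j → 1 ≤ Y i j) →
           ∑size₂ k X + ∑size₂ k Y ≤ ∑size₂ k (X ⊗ Y) + k * k
∑size₂-⊗ k X Y 1≤X 1≤Y = begin
  ∑size₂ k X + ∑size₂ k Y
    ≡⟨ cong₂ _+_ (∑size₂≡∑∑ k X) (∑size₂≡∑∑ k Y) ⟩
  ∑[ i < k ] ∑[ j < k ] size₂ (X i j) + ∑[ i < k ] ∑[ j < k ] size₂ (Y i j)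
    ≤⟨ ∑∑-latin-pairing _ _ (λ i j → Z i j + 1)
         (λ i j → size₂-⊗-entry X Y i (i ⊕ j) j (1≤X i (i ⊕ j)) (1≤Y (i ⊕ j) j)) ⟩
  ∑[ i < k ] ∑[ j < k ] (Z i j + 1)
    ≡⟨ sum-cong-≗ (λ i → trans (∑-distrib-+ (Z i) (λ _ → 1)) (cong (sum (Z i) +_) (sum-const k 1))) ⟩
  ∑[ i < k ] (sum (Z i) + k * 1)
    ≡⟨ ∑-distrib-+ (λ i → sum (Z i)) (λ _ → k * 1) ⟩
  ∑[ i < k ] sum (Z i) + ∑[ i < k ] (k * 1)
    ≡⟨ cong₂ _+_ (∑size₂≡∑∑ k (X ⊗ Y)) (trans (cong (k *_) (sym (*-identityʳ k))) (sym (sum-const k (k * 1)))) ⟨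
  ∑size₂ k (X ⊗ Y) + k * k
    ∎
  where
  open ≤-Reasoning
  open CyclicShift k
  Z : Fin k → Fin k → ℕ
  Z i j = size₂ ((X ⊗ Y) i j)

[x+m∸1]+[y+m∸1]≤[z+m∸1]+2*m∸1 : ∀ {x y z} m .{{_ : NonZero m}} → x + y ≤ z + m →
                                 (x + m ∸ 1) + (y + m ∸ 1) ≤ (z + m ∸ 1) + 2 * m ∸ 1
[x+m∸1]+[y+m∸1]≤[z+m∸1]+2*m∸1 {x} {y} {z} m@(suc p) x+y≤z+m = begin
  (x + m ∸ 1) + (y + m ∸ 1)      ≡⟨ cong₂ _+_ (pred-+suc x) (pred-+suc y) ⟩
  (x + p) + (y + p)              ≡⟨ regroupˡ x y p ⟩
  (x + y) + (p + p)              ≤⟨ +-monoˡ-≤ (p + p) x+y≤z+m ⟩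
  (z + m) + (p + p)              ≡⟨ regroupʳ z p ⟩
  (z + p) + (p + (m + 0))        ≡⟨ pred-+suc (z + p) ⟨    -- 2 * m ∸ 1 unfolds to p + (m + 0)
  (z + p) + 2 * m ∸ 1            ≡⟨ cong (λ w → w + 2 * m ∸ 1) (pred-+suc z) ⟨
  (z + m ∸ 1) + 2 * m ∸ 1        ∎
  where
  open ≤-Reasoning
  pred-+suc : ∀ {q} w → w + suc q ∸ 1 ≡ w + q
  pred-+suc w = cong (_∸ 1) (+-suc w _)
  regroupˡ : ∀ x y p → (x + p) + (y + p) ≡ (x + y) + (p + p)
  regroupˡ = solve-∀
  regroupʳ : ∀ z p → (z + suc p) + (p + p) ≡ (z + p) + (p + (suc p + 0))
  regroupʳ = solve-∀

lemma13 : (k : ℕ) → 1 ≤ k → (X Y : Mat k) → (∀ i j → 1 ≤ X i j) → (∀ i j → 1 ≤ Y i j) → size₂M k X + size₂M k Y ≤ size₂M k (X ⊗ Y) + 2 * (k * k) ∸ 1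
lemma13 k 1≤k X Y 1≤X 1≤Y =
  [x+m∸1]+[y+m∸1]≤[z+m∸1]+2*m∸1 {∑size₂ k X} {∑size₂ k Y} {∑size₂ k (X ⊗ Y)} (k * k) {{m*n≢0 k k}} (∑size₂-⊗ k X Y 1≤X 1≤Y)
  where instance
  k≢0 : NonZero k
  k≢0 = >-nonZero 1≤k
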